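{- Let $p\in\mathrm{PROP}$. The class $\mathfrak{F}^s_{\mathsf{EF}p}=\{(K,T)\mid K,T\models_s\mathsf{EF}p\}$ is not definable in asynchronous semantics, i.e., there is no CTL-formula $\psi$ with $\mathfrak{F}^a_\psi=\mathfrak{F}^s_{\mathsf{EF}p}$, where $\mathfrak{F}^a_\psi=\{(K,T)\mid K,T\models_a\psi\}$.
   Context: Fix a finite set $\mathrm{PROP}$ of proposition symbols. CTL-formulas (in negation normal form) are generated by $\varphi ::= p \mid \neg p \mid (\varphi\wedge\varphi) \mid (\varphi\vee\varphi) \mid \mathsf{P}\mathsf{X}\varphi \mid \mathsf{P}[\varphi\,\mathsf{U}\,\varphi] \mid \mathsf{P}[\varphi\,\mathsf{W}\,\varphi]$ with $\mathsf{P}\in\{\mathsf{A},\mathsf{E}\}$, $p\in\mathrm{PROP}$; $\top:=p\vee\neg p$, $\mathsf{EF}\varphi:=\mathsf{E}[\top\mathsf{U}\varphi]$. A Kripke structure is $K=(W,R,\eta)$ with $W$ finite non-empty, $R\subseteq W\times W$ total, $\eta: W\to 2^{\mathrm{PROP}}$. A path is an infinite sequence $\pi(1),\pi(2),\dots$ with $\pi(i)R\pi(i+1)$; $\Pi(w)$ is the set of paths with $\pi(1)=w$. A team of $K$ is a finite multiset $T$ of elements of $W$; $T_1\sqcup T_2$ is multiset union. Classes range over pairs $(K,T)$ with $K$ any Kripke structure and $T$ any team of $K$. For $T=\{\!\{t_1,\dots,t_n\}\!\}$ (with multiplicity), with $\vdash$ either $\models_s$ or $\models_a$: $K,T\vdash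 p$ iff $p\in\eta(w)$ for all $w\in T$; $K,T\vdash\neg p$ iff $p\notin\eta(w)$ for all $w\in T$; $\wedge$ conjunctively; $K,T\vdash\varphi\vee\psi$ iff there are teams $T_1\sqcup T_2=T$ with $K,T_1\vdash\varphi$, $K,T_2\vdash\psi$; $K,T\vdash\mathsf{EX}\varphi$ iff there exist $\pi_j\in\Pi(t_j)$ with $K,\{\!\{\pi_1(2),\dots,\pi_n(2)\}\!\}\vdash\varphi$; $\mathsf{AX}$ likewise with "for all". Let $\mathcal{Q}=\exists$ if $\mathsf{P}=\mathsf{E}$, $\mathcal{Q}=\forall$ if $\mathsf{P}=\mathsf{A}$. Synchronous: $K,T\models_s\mathsf{P}[\varphi\mathsf{U}\psi]$ iff $\mathcal{Q}\pi_1\in\Pi(t_1),\dots,\mathcal{Q}\pi_n\in\Pi(t_n)$ $\exists k\ge1$: $K,\{\!\{\pi_j(k)\}\!\}_j\models_s\psi$ and $K,\{\!\{\pi_j(i)\}\!\}_j\models_s\varphi$ for all $1\le i<k$; $\mathsf{P}[\varphi\mathsf{W}\psi]$: $\mathcal{Q}\pi_1,\dots,\mathcal{Q}\pi_n$: ($\forall i\ge1$: $K,\{\!\{\pi_j(i)\}\!\}_j\models_s\varphi$) or the until condition. Asynchronous: $K,T\models_a\mathsf{P}[\varphi\mathsf{U}\psi]$ iff $\mathcal{Q}\pi_1,\dots,\mathcal{Q}\pi_n$ $\exists k_1,\dots,k_n\ge1$: $K,\{\!\{\pi_j(k_j)\}\!\}_j\models_a\psi$ and $K,\{\!\{\pi_j(i_j)\}\!\}_j\models_a\varphi$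 for all $i_1,\dots,i_n$ with $1\le i_j<k_j$; $\mathsf{P}[\varphi\mathsf{W}\psi]$: $\mathcal{Q}\pi_1,\dots,\mathcal{Q}\pi_n$: (for all $i_1,\dots,i_n\ge1$: $K,\{\!\{\pi_j(i_j)\}\!\}_j\models_a\varphi$) or the asynchronous until condition. -}

module Defs where

open import Data.Nat using (ℕ; zero; suc; _<_)
open import Data.Fin using (Fin)
open import Data.Bool using (Bool; true; false)
open import Data.List using (List; length; lookup; tabulate; _++_)
open import Data.List.Relation.Binary.Permutation.Propositional using (_↭_)
open import Data.Product using (Σ; ∃; _×_; _,_; proj₁)
open import Data.Sum using (_⊎_)
open import Relation.Binary.PropositionalEquality using (_≡_)

data PQ : Set where
  𝔸 𝔼 : PQ

-- CTL formulas in negation normal form over PROP = Fin m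
data Formula (m : ℕ) : Set where
  prop  : Fin m → Formula m
  nprop : Fin m → Formula m
  _∧ᶠ_  : Formula m → Formula m → Formula m
  _∨ᶠ_  : Formula m → Formula m → Formula m
  X     : PQ → Formula m → Formula m
  U     : PQ → Formula m → Formula m → Formula m
  W     : PQ → Formula m → Formula m → Formula m

⊤ᶠ : ∀ {m} → Fin m → Formula m
⊤ᶠ p = prop p ∨ᶠ nprop p

EF : ∀ {m} → Fin m → Formula m
EF p = U 𝔼 (⊤ᶠ p) (prop p)

-- Kripke structure: worlds Fin (suc n) (finite, non-empty),
-- total relation R, valuation η : W → 2^PROP (as characteristic function).
record Kripke (m n : ℕ) : Set₁ where
  field
    R     : Fin (suc n) → Fin (suc n) → Set
    total : ∀ w → ∃ λ v → R w v
    η     : Fin (suc n) → Fin m → Bool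

module _ {m n : ℕ} (K : Kripke m n) where
  open Kripke K

  World : Set
  World = Fin (suc n)

  -- Teams: finite multisets, represented as lists (up to permutation).
  Team : Set
  Team = List World

  -- Paths, indexed from 0 (π 0 is the paper's π(1)).
  Path : World → Set
  Path w = Σ (ℕ → World) λ π → (π 0 ≡ w) × (∀ i → R (π i) (π (suc i)))

  Paths : Team → Set
  Paths T = (j : Fin (length T)) → Path (lookup T j)

  Quant : PQ → (T : Team) → (Paths T → Set) → Set
  Quant 𝔼 T P = Σ (Paths T) P
  Quant 𝔸 T P = (πs : Paths T) → P πs

  at : (T : Team) → Paths T → (Fin (length T) → ℕ) → Team
  at T πs ks = tabulate λ j → proj₁ (πs j) (ks j)

  atS : (T : Team) → Paths T → ℕ → Team
  atS T πs k = at T πs (λ _ → k)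

  _⊨s_ : Team → Formula m → Set
  T ⊨s prop p  = ∀ j → η (lookup T j) p ≡ true
  T ⊨s nprop p = ∀ j → η (lookup T j) p ≡ false
  T ⊨s (φ ∧ᶠ ψ) = (T ⊨s φ) × (T ⊨s ψ)
  T ⊨s (φ ∨ᶠ ψ) = Σ Team λ T₁ → Σ Team λ T₂ → ((T₁ ++ T₂) ↭ T) × (T₁ ⊨s φ) × (T₂ ⊨s ψ)
  T ⊨s X P φ = Quant P T λ πs → atS T πs 1 ⊨s φ
  T ⊨s U P φ ψ = Quant P T λ πs →
    Σ ℕ λ k → (atS T πs k ⊨s ψ) × (∀ i → i < k → atS T πs i ⊨s φ)
  T ⊨s W P φ ψ = Quant P T λ πs →
    (∀ i → atS T πs i ⊨s φ) ⊎
    (Σ ℕ λ k → (atS T πs k ⊨s ψ) × (∀ i → i < k → atS T πs i ⊨s φ))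

  _⊨a_ : Team → Formula m → Set
  T ⊨a prop p  = ∀ j → η (lookup T j) p ≡ true
  T ⊨a nprop p = ∀ j → η (lookup T j) p ≡ false
  T ⊨a (φ ∧ᶠ ψ) = (T ⊨a φ) × (T ⊨a ψ)
  T ⊨a (φ ∨ᶠ ψ) = Σ Team λ T₁ → Σ Team λ T₂ → ((T₁ ++ T₂) ↭ T) × (T₁ ⊨a φ) × (T₂ ⊨a ψ)
  T ⊨a X P φ = Quant P T λ πs → atS T πs 1 ⊨a φ
  T ⊨a U P φ ψ = Quant P T λ πs →
    Σ (Fin (length T) → ℕ) λ ks → (at T πs ks ⊨a ψ) ×
      (∀ (is : Fin (length T) → ℕ) → (∀ j → is j < ks j) → at T πs is ⊨a φ)
  T ⊨a W P φ ψ = Quant P T λ πs →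
    (∀ (is : Fin (length T) → ℕ) → at T πs is ⊨a φ) ⊎
    (Σ (Fin (length T) → ℕ) λ ks → (at T πs ks ⊨a ψ) ×
      (∀ (is : Fin (length T) → ℕ) → (∀ j → is j < ks j) → at T πs is ⊨a φ))

module Submission where

-- Work in the countdown structure on worlds 0, …, n, where every world steps to its
-- predecessor (0 loops) and p holds only at 1. Synchronously EF p holds of the team
-- {x, x} but fails for {x, x − 1}, since the two (unique) paths would have to reach 1 at
-- the same moment. Asynchronously, positions that are equal or both at least d + 2 are
-- indistinguishable by formulas with at most d nested X: along an until, the higher
-- path can wait while the other descends to the level that matters. Taking x ≥ d + 3,
-- the two teams satisfy the same asynchronous formulas of next-depth d, so no ψ
-- defines EF p.

open import Defs
open import Data.Nat using (ℕ; zero; suc; _+_; _∸_; _⊔_; _≤_; _<_; _≡ᵇ_; s≤s; z≤n; _≤?_)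
open import Data.Nat.Properties
  using (+-comm; ≤-refl; ≤-trans; ≤-reflexive; <⇒≤; <-≤-trans; ≰⇒>; n≤1+n; 0≢1+n; ≡ᵇ⇒≡;
         m⊔n≤o⇒m≤o; m⊔n≤o⇒n≤o; m∸[m∸n]≡n; m∸n≤m; ∸-monoʳ-<; ∸-monoˡ-≤; ∸-cancelʳ-<; ∸-+-assoc;
         pred[m∸n]≡m∸[1+n])
open import Data.Fin using (Fin; zero; suc; toℕ; pred; fromℕ)
open import Data.Fin.Properties using (toℕ-fromℕ; toℕ-inject₁)
open import Data.Vec.Functional using () renaming (_∷_ to _∷ᵛ_)
open import Data.Bool using (true; false)
open import Data.Bool.Properties using (T-≡)
open import Data.List using (List; []; _∷_; length; lookup; _++_)
open import Data.List.Relation.Binary.Pointwise using (Pointwise; []; _∷_)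
open import Data.List.Relation.Binary.Permutation.Propositional
  using (_↭_; prep; swap) renaming (refl to ↭-refl; trans to ↭-trans)
open import Data.List.Relation.Binary.Permutation.Propositional.Properties using (shift)
open import Data.Product using (Σ; _×_; _,_; proj₁; proj₂)
import Data.Product as Product
import Data.Sum as Sum
open import Data.Sum using (_⊎_; inj₁; inj₂)
open import Function using (_∘_)
open import Function.Bundles using (Equivalence)
open import Relation.Binary using (REL)
open import Relation.Nullary using (¬_; yes; no)
open import Relation.Binary.PropositionalEquality using (_≡_; refl; sym; trans; cong; subst; module ≡-Reasoning)

Near : ℕ → ℕ → ℕ → Set
Near d a b = a ≡ b ⊎ (2 + d ≤ a × 2 + d ≤ b)

near-≡ᵇ1 : ∀ {d a b} → Near d a b → (a ≡ᵇ 1) ≡ (b ≡ᵇ 1)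
near-≡ᵇ1 (inj₁ refl) = refl
near-≡ᵇ1 (inj₂ (s≤s (s≤s _) , s≤s (s≤s _))) = refl

near-∸1 : ∀ {d a b} → Near (suc d) a b → Near d (a ∸ 1) (b ∸ 1)
near-∸1 (inj₁ refl) = inj₁ refl
near-∸1 (inj₂ (s≤s Da , s≤s Db)) = inj₂ (Da , Db)

near-anytime : ∀ {d a a'} → Near d a a' → ∀ i' → Σ ℕ λ i → Near d (a ∸ i) (a' ∸ i')
near-anytime (inj₁ refl) i' = i' , inj₁ refl
near-anytime {d} {a} {a'} (inj₂ (Da , Da')) i' with 2 + d ≤? a' ∸ i'
... | yes Db = 0 , inj₂ (Da , Db)
... | no ¬Db = a ∸ (a' ∸ i') , inj₁ (m∸[m∸n]≡n (≤-trans (<⇒≤ (≰⇒> ¬Db)) Da))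

-- Once the first position is below the threshold 2 + d at time k, the second is stopped at
-- that same level; its earlier positions are matched by time 0 of the first while they are
-- above the threshold, and by the first's own visit to the same level once below it.
near-until : ∀ {d a a'} → Near d a a' → ∀ k → Σ ℕ λ k' → Near d (a ∸ k) (a' ∸ k') ×
  (∀ i' → i' < k' → Σ ℕ λ i → i < k × Near d (a ∸ i) (a' ∸ i'))
near-until (inj₁ refl) k = k , inj₁ refl , λ i' i'<k → i' , i'<k , inj₁ refl
near-until {d} {a} {a'} (inj₂ (Da , Da')) k with 2 + d ≤? a ∸ k
... | yes Dc = 0 , inj₂ (Dc , Da') , λ _ ()
... | no ¬Dc = a' ∸ c , inj₁ (sym (m∸[m∸n]≡n c≤a')) , earlier
  where
  c : ℕ
  c = a ∸ k
  c<D : c < 2 + d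
  c<D = ≰⇒> ¬Dc
  c≤a' : c ≤ a'
  c≤a' = ≤-trans (<⇒≤ c<D) Da'
  earlier : ∀ i' → i' < a' ∸ c → Σ ℕ λ i → i < k × Near d (a ∸ i) (a' ∸ i')
  earlier i' i'<k' with 2 + d ≤? a' ∸ i'
  ... | yes Db = 0 , ∸-cancelʳ-< (<-≤-trans c<D Da) , inj₂ (Da , Db)
  ... | no ¬Db = a ∸ b , ∸-cancelʳ-< c<a∸[a∸b] , inj₁ a∸[a∸b]≡b
    where
    b : ℕ
    b = a' ∸ i'
    a∸[a∸b]≡b : a ∸ (a ∸ b) ≡ b
    a∸[a∸b]≡b = m∸[m∸n]≡n (≤-trans (<⇒≤ (≰⇒> ¬Db)) Da)
    c<b : c < b
    c<b = subst (_< b) (m∸[m∸n]≡n c≤a') (∸-monoʳ-< i'<k' (m∸n≤m a' c))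
    c<a∸[a∸b] : c < a ∸ (a ∸ b)
    c<a∸[a∸b] = subst (c <_) (sym a∸[a∸b]≡b) c<b

module _ {a b ℓ} {A : Set a} {B : Set b} {R : REL A B ℓ} where

  Pointwise-↭ : ∀ {xs ys ys'} → xs ↭ ys → Pointwise R ys ys' →
    Σ (List B) λ xs' → (xs' ↭ ys') × Pointwise R xs xs'
  Pointwise-↭ ↭-refl rs = _ , ↭-refl , rs
  Pointwise-↭ (prep x p) (r ∷ rs) with Pointwise-↭ p rs
  ... | xs' , p' , rs' = _ , prep _ p' , r ∷ rs'
  Pointwise-↭ (swap x y p) (r₁ ∷ r₂ ∷ rs) with Pointwise-↭ p rs
  ... | xs' , p' , rs' = _ , swap _ _ p' , r₂ ∷ r₁ ∷ rs'
  Pointwise-↭ (↭-trans p q) rs with Pointwise-↭ q rs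
  ... | ys' , q' , rs₁ with Pointwise-↭ p rs₁
  ... | xs' , p' , rs₂ = xs' , ↭-trans p' q' , rs₂

  Pointwise-++⁻ : ∀ xs ys {zs} → Pointwise R (xs ++ ys) zs →
    Σ (List B) λ zs₁ → Σ (List B) λ zs₂ → (zs ≡ zs₁ ++ zs₂) × Pointwise R xs zs₁ × Pointwise R ys zs₂
  Pointwise-++⁻ [] ys rs = [] , _ , refl , [] , rs
  Pointwise-++⁻ (x ∷ xs) ys (r ∷ rs) with Pointwise-++⁻ xs ys rs
  ... | zs₁ , zs₂ , refl , rs₁ , rs₂ = _ ∷ zs₁ , zs₂ , refl , r ∷ rs₁ , rs₂

⊨s-⊤ᶠ : ∀ {m n} (K : Kripke m n) (p : Fin m) (T : Team K) → _⊨s_ K T (⊤ᶠ p)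
⊨s-⊤ᶠ K p [] = [] , [] , ↭-refl , (λ ()) , (λ ())
⊨s-⊤ᶠ K p (w ∷ T) with ⊨s-⊤ᶠ K p T | Kripke.η K w p in ηw
... | T₁ , T₂ , ↭T , h₁ , h₂ | true =
  w ∷ T₁ , T₂ , prep w ↭T , (λ { zero → ηw ; (suc j) → h₁ j }) , h₂
... | T₁ , T₂ , ↭T , h₁ , h₂ | false =
  T₁ , w ∷ T₂ , ↭-trans (shift w T₁ T₂) (prep w ↭T) , h₁ , (λ { zero → ηw ; (suc j) → h₂ j })

nextDepth : ∀ {m} → Formula m → ℕ
nextDepth (prop _) = 0
nextDepth (nprop _) = 0
nextDepth (φ ∧ᶠ ψ) = nextDepth φ ⊔ nextDepth ψ
nextDepth (φ ∨ᶠ ψ) = nextDepth φ ⊔ nextDepth ψ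
nextDepth (X _ φ) = suc (nextDepth φ)
nextDepth (U _ φ ψ) = nextDepth φ ⊔ nextDepth ψ
nextDepth (W _ φ ψ) = nextDepth φ ⊔ nextDepth ψ

≡ᵇ1⇒≡1 : ∀ {a} → (a ≡ᵇ 1) ≡ true → a ≡ 1
≡ᵇ1⇒≡1 {a} eq = ≡ᵇ⇒≡ a 1 (Equivalence.from T-≡ eq)

toℕ-pred : ∀ {n} (w : Fin (suc n)) → toℕ (pred w) ≡ toℕ w ∸ 1
toℕ-pred zero = refl
toℕ-pred (suc i) = toℕ-inject₁ i

module Countdown (m n : ℕ) where

  countdown : Kripke m n
  countdown = record
    { R = λ w v → v ≡ pred w ; total = λ w → pred w , refl ; η = λ w _ → toℕ w ≡ᵇ 1 }

  _⊨_ : Team countdown → Formula m → Set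
  _⊨_ = _⊨a_ countdown

  descend : ℕ → World countdown → World countdown
  descend zero w = w
  descend (suc i) w = pred (descend i w)

  canonical : (T : Team countdown) → Paths countdown T
  canonical T j = (λ i → descend i (lookup T j)) , refl , λ _ → refl

  path-position : ∀ {w} (π : Path countdown w) i → toℕ (proj₁ π i) ≡ toℕ w ∸ i
  path-position (π , refl , step) zero = refl
  path-position {w} (π , refl , step) (suc i) = begin
    toℕ (π (suc i))     ≡⟨ cong toℕ (step i) ⟩
    toℕ (pred (π i))    ≡⟨ toℕ-pred (π i) ⟩
    toℕ (π i) ∸ 1       ≡⟨ cong (_∸ 1) (path-position (π , refl , step) i) ⟩
    toℕ w ∸ i ∸ 1       ≡⟨ ∸-+-assoc (toℕ w) i 1 ⟩
    toℕ w ∸ (i + 1)     ≡⟨ cong (toℕ w ∸_) (+-comm i 1) ⟩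
    toℕ w ∸ suc i       ∎
    where open ≡-Reasoning

  NearTeams : ℕ → Team countdown → Team countdown → Set
  NearTeams d = Pointwise λ x y → Near d (toℕ x) (toℕ y)

  path-near : ∀ {d x y} (π : Path countdown x) (π' : Path countdown y) {i i'} →
    Near d (toℕ x ∸ i) (toℕ y ∸ i') → Near d (toℕ (proj₁ π i)) (toℕ (proj₁ π' i'))
  path-near π π' {i} {i'} r rewrite path-position π i | path-position π' i' = r

  Times : Team countdown → Set
  Times T = Fin (length T) → ℕ

  Below : ∀ {k} → (Fin k → ℕ) → (Fin k → ℕ) → Set
  Below is ks = ∀ j → is j < ks j

  nearTeams-≡ᵇ1 : ∀ {d T T'} → NearTeams d T T' → ∀ b →
    (∀ j → (toℕ (lookup T j) ≡ᵇ 1) ≡ b) → ∀ j → (toℕ (lookup T' j) ≡ᵇ 1) ≡ b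
  nearTeams-≡ᵇ1 (r ∷ rs) b h zero = trans (sym (near-≡ᵇ1 r)) (h zero)
  nearTeams-≡ᵇ1 (r ∷ rs) b h (suc j) = nearTeams-≡ᵇ1 rs b (h ∘ suc) j

  nearTeams-split : ∀ {d T T'} T₁ T₂ → (T₁ ++ T₂) ↭ T → NearTeams d T T' →
    Σ (Team countdown) λ T₁' → Σ (Team countdown) λ T₂' →
      ((T₁' ++ T₂') ↭ T') × NearTeams d T₁ T₁' × NearTeams d T₂ T₂'
  nearTeams-split T₁ T₂ ↭T rs with Pointwise-↭ ↭T rs
  ... | _ , ↭T' , rs' with Pointwise-++⁻ T₁ T₂ rs'
  ... | T₁' , T₂' , refl , rs₁ , rs₂ = T₁' , T₂' , ↭T' , rs₁ , rs₂

  nearTeams-next : ∀ {d T T'} → NearTeams (suc d) T T' → (πs : Paths countdown T) (πs' : Paths countdown T') →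
    NearTeams d (atS countdown T πs 1) (atS countdown T' πs' 1)
  nearTeams-next [] πs πs' = []
  nearTeams-next (r ∷ rs) πs πs' =
    path-near (πs zero) (πs' zero) (near-∸1 r) ∷ nearTeams-next rs (πs ∘ suc) (πs' ∘ suc)

  nearTeams-anytime : ∀ {d T T'} → NearTeams d T T' → (πs : Paths countdown T) (πs' : Paths countdown T') →
    ∀ is' → Σ (Times T) λ is → NearTeams d (at countdown T πs is) (at countdown T' πs' is')
  nearTeams-anytime [] πs πs' is' = (λ ()) , []
  nearTeams-anytime (r ∷ rs) πs πs' is'
    with near-anytime r (is' zero) | nearTeams-anytime rs (πs ∘ suc) (πs' ∘ suc) (is' ∘ suc)
  ... | i , ri | is , ris = i ∷ᵛ is , path-near (πs zero) (πs' zero) ri ∷ ris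

  nearTeams-until : ∀ {d T T'} → NearTeams d T T' → (πs : Paths countdown T) (πs' : Paths countdown T') →
    ∀ ks → Σ (Times T') λ ks' → NearTeams d (at countdown T πs ks) (at countdown T' πs' ks') ×
      (∀ is' → Below is' ks' →
        Σ (Times T) λ is → Below is ks × NearTeams d (at countdown T πs is) (at countdown T' πs' is'))
  nearTeams-until [] πs πs' ks = (λ ()) , [] , λ _ _ → (λ ()) , (λ ()) , []
  nearTeams-until {d} {T} {T'} (r ∷ rs) πs πs' ks
    with near-until r (ks zero) | nearTeams-until rs (πs ∘ suc) (πs' ∘ suc) (ks ∘ suc)
  ... | k' , rk , earlier | ks' , rks , earliers =
    k' ∷ᵛ ks' , path-near (πs zero) (πs' zero) rk ∷ rks , matching
    where
    matching : ∀ is' → Below is' (k' ∷ᵛ ks') →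
      Σ (Times T) λ is → Below is ks × NearTeams d (at countdown T πs is) (at countdown T' πs' is')
    matching is' is'<ks' with earlier (is' zero) (is'<ks' zero) | earliers (is' ∘ suc) (is'<ks' ∘ suc)
    ... | i , i<k , ri | is , is<ks , ris =
      i ∷ᵛ is , (λ { zero → i<k ; (suc j) → is<ks j }) , path-near (πs zero) (πs' zero) ri ∷ ris

  -- Paths in the countdown are unique, so a canonical choice serves as the witness for 𝔼
  -- and as the instance for 𝔸.
  quant-transfer : ∀ P {T T'} {B : Paths countdown T → Set} {B' : Paths countdown T' → Set} →
    (∀ πs πs' → B πs → B' πs') → Quant countdown P T B → Quant countdown P T' B'
  quant-transfer 𝔼 {T' = T'} f (πs , b) = canonical T' , f πs (canonical T') b
  quant-transfer 𝔸 {T} f h πs' = f (canonical T) πs' (h (canonical T))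

  AsyncUntil : (T : Team countdown) → Paths countdown T → Formula m → Formula m → Set
  AsyncUntil T πs φ ψ = Σ (Times T) λ ks → (at countdown T πs ks ⊨ ψ) ×
    (∀ is → Below is ks → at countdown T πs is ⊨ φ)

  AsyncGlobally : (T : Team countdown) → Paths countdown T → Formula m → Set
  AsyncGlobally T πs φ = ∀ is → at countdown T πs is ⊨ φ

  module _ {d} (φ ψ : Formula m)
    (φ-invariant : ∀ {S S'} → NearTeams d S S' → S ⊨ φ → S' ⊨ φ)
    (ψ-invariant : ∀ {S S'} → NearTeams d S S' → S ⊨ ψ → S' ⊨ ψ) where

    until-transfer : ∀ {T T'} → NearTeams d T T' → ∀ πs πs' → AsyncUntil T πs φ ψ → AsyncUntil T' πs' φ ψ
    until-transfer rs πs πs' (ks , hψ , hφ) with nearTeams-until rs πs πs' ks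
    ... | ks' , rks , matching = ks' , ψ-invariant rks hψ , λ is' is'<ks' →
      let (is , is<ks , ris) = matching is' is'<ks' in φ-invariant ris (hφ is is<ks)

  globally-transfer : ∀ {d} φ {T T'} → (∀ {S S'} → NearTeams d S S' → S ⊨ φ → S' ⊨ φ) →
    NearTeams d T T' → ∀ πs πs' → AsyncGlobally T πs φ → AsyncGlobally T' πs' φ
  globally-transfer φ φ-invariant rs πs πs' hφ is' =
    let (is , ris) = nearTeams-anytime rs πs πs' is' in φ-invariant ris (hφ is)

  ⊨-nearTeams-invariant : ∀ ψ {d T T'} → nextDepth ψ ≤ d → NearTeams d T T' → T ⊨ ψ → T' ⊨ ψ
  ⊨-nearTeams-invariant (prop _) _ rs = nearTeams-≡ᵇ1 rs true
  ⊨-nearTeams-invariant (nprop _) _ rs = nearTeams-≡ᵇ1 rs false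
  ⊨-nearTeams-invariant (φ ∧ᶠ ψ) le rs =
    Product.map (⊨-nearTeams-invariant φ (m⊔n≤o⇒m≤o _ _ le) rs) (⊨-nearTeams-invariant ψ (m⊔n≤o⇒n≤o _ _ le) rs)
  ⊨-nearTeams-invariant (φ ∨ᶠ ψ) le rs (T₁ , T₂ , ↭T , h₁ , h₂) with nearTeams-split T₁ T₂ ↭T rs
  ... | T₁' , T₂' , ↭T' , rs₁ , rs₂ = T₁' , T₂' , ↭T' ,
    ⊨-nearTeams-invariant φ (m⊔n≤o⇒m≤o _ _ le) rs₁ h₁ , ⊨-nearTeams-invariant ψ (m⊔n≤o⇒n≤o _ _ le) rs₂ h₂
  ⊨-nearTeams-invariant (X P φ) (s≤s le) rs =
    quant-transfer P λ πs πs' → ⊨-nearTeams-invariant φ le (nearTeams-next rs πs πs')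
  ⊨-nearTeams-invariant (U P φ ψ) le rs = quant-transfer P (until-transfer φ ψ
    (⊨-nearTeams-invariant φ (m⊔n≤o⇒m≤o _ _ le)) (⊨-nearTeams-invariant ψ (m⊔n≤o⇒n≤o _ _ le)) rs)
  ⊨-nearTeams-invariant (W P φ ψ) {d} le rs = quant-transfer P λ πs πs' →
    Sum.map (globally-transfer φ φ-invariant rs πs πs') (until-transfer φ ψ φ-invariant ψ-invariant rs πs πs')
    where
    φ-invariant : ∀ {S S'} → NearTeams d S S' → S ⊨ φ → S' ⊨ φ
    φ-invariant = ⊨-nearTeams-invariant φ (m⊔n≤o⇒m≤o _ _ le)
    ψ-invariant : ∀ {S S'} → NearTeams d S S' → S ⊨ ψ → S' ⊨ ψ
    ψ-invariant = ⊨-nearTeams-invariant ψ (m⊔n≤o⇒n≤o _ _ le)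

  _⊨ˢ_ : Team countdown → Formula m → Set
  _⊨ˢ_ = _⊨s_ countdown

  twins⊨ˢEF : ∀ p w → 0 < toℕ w → (w ∷ w ∷ []) ⊨ˢ EF p
  twins⊨ˢEF p w 0<w =
    canonical _ , toℕ w ∸ 1 , (λ { zero → at-1 ; (suc zero) → at-1 }) , λ _ _ → ⊨s-⊤ᶠ countdown p _
    where
    at-1 : (toℕ (descend (toℕ w ∸ 1) w) ≡ᵇ 1) ≡ true
    at-1 = cong (_≡ᵇ 1) (trans (path-position (canonical (w ∷ []) zero) (toℕ w ∸ 1)) (m∸[m∸n]≡n 0<w))

  staggered⊭ˢEF : ∀ p w → ¬ (w ∷ pred w ∷ []) ⊨ˢ EF p
  staggered⊭ˢEF p w (πs , k , at-p , _) =
    0≢1+n (trans (sym (cong Data.Nat.pred first)) (trans (pred[m∸n]≡m∸[1+n] c k) second))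
    where
    open ≡-Reasoning
    c : ℕ
    c = toℕ w
    first : c ∸ k ≡ 1
    first = trans (sym (path-position (πs zero) k)) (≡ᵇ1⇒≡1 (at-p zero))
    second : c ∸ suc k ≡ 1
    second = begin
      c ∸ suc k                      ≡⟨ sym (∸-+-assoc c 1 k) ⟩
      c ∸ 1 ∸ k                      ≡⟨ cong (_∸ k) (sym (toℕ-pred w)) ⟩
      toℕ (pred w) ∸ k               ≡⟨ sym (path-position (πs (suc zero)) k) ⟩
      toℕ (proj₁ (πs (suc zero)) k)  ≡⟨ ≡ᵇ1⇒≡1 (at-p (suc zero)) ⟩
      1                              ∎

  twins-nearTeams-staggered : ∀ d w → 3 + d ≤ toℕ w → NearTeams d (w ∷ w ∷ []) (w ∷ pred w ∷ [])
  twins-nearTeams-staggered d w high =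
    inj₁ refl ∷ inj₂ (≤-trans (n≤1+n _) high , ≤-trans (∸-monoˡ-≤ 1 high) (≤-reflexive (sym (toℕ-pred w))))
    ∷ []

mainTheorem7 : (m : ℕ) (p : Fin m) →
    ¬ Σ (Formula m) (λ ψ → ∀ (n : ℕ) (K : Kripke m n) (T : Team K) →
    ((_⊨a_ K T ψ → _⊨s_ K T (EF p)) × (_⊨s_ K T (EF p) → _⊨a_ K T ψ)))
mainTheorem7 m p (ψ , ψ-defines) =
  staggered⊭ˢEF p x (proj₁ (ψ-defines n countdown staggered) staggered⊨ψ)
  where
  d n : ℕ
  d = nextDepth ψ
  n = 3 + d
  open Countdown m n
  x : World countdown
  x = fromℕ n
  x-high : 3 + d ≤ toℕ x
  x-high = ≤-reflexive (sym (toℕ-fromℕ n))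
  twins staggered : Team countdown
  twins = x ∷ x ∷ []
  staggered = x ∷ pred x ∷ []
  twins⊨ψ : twins ⊨ ψ
  twins⊨ψ = proj₂ (ψ-defines n countdown twins) (twins⊨ˢEF p x (<-≤-trans (s≤s z≤n) x-high))
  staggered⊨ψ : staggered ⊨ ψ
  staggered⊨ψ = ⊨-nearTeams-invariant ψ ≤-refl (twins-nearTeams-staggered d x x-high) twins⊨ψ
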